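{- For every integer $k\geq 5$, there is an extremal overlap-free word of length $2^k+1$ over $\{\mathtt{0},\mathtt{1}\}$.
   Context: An overlap is a word $axaxa$ with $a$ a letter, $x$ possibly empty; a word is overlap-free if it has no overlap as a factor. An extension of a word $w$ over $\{\mathtt{0},\mathtt{1}\}$ is a word $w'aw''$ with $a\in\{\mathtt{0},\mathtt{1}\}$ and $w'w''=w$; $w$ is extremal overlap-free if it is overlap-free and every extension of $w$ contains an overlap. -}

module Defs where

open import Data.Bool using (Bool)
open import Data.List using (List; []; _∷_; _++_; [_])
open import Data.Product using (∃; ∃-syntax; _×_; _,_)
open import Relation.Nullary using (¬_)
open import Relation.Binary.PropositionalEquality using (_≡_)

-- Binary words over {0,1}, encoded as lists of Bool (false = 0, true = 1).
Word : Set
Word = List Bool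

_isFactorOf_ : Word → Word → Set
f isFactorOf w = ∃[ u ] ∃[ v ] (w ≡ u ++ f ++ v)

IsOverlap : Word → Set
IsOverlap f = ∃[ a ] ∃[ x ] (f ≡ a ∷ x ++ a ∷ x ++ [ a ])

ContainsOverlap : Word → Set
ContainsOverlap w = ∃[ f ] (f isFactorOf w × IsOverlap f)

OverlapFree : Word → Set
OverlapFree w = ¬ ContainsOverlap w

_isExtensionOf_ : Word → Word → Set
w' isExtensionOf w = ∃[ w₁ ] ∃[ w₂ ] ∃[ a ] (w₁ ++ w₂ ≡ w × w' ≡ w₁ ++ a ∷ w₂)

ExtremalOverlapFree : Word → Set
ExtremalOverlapFree w =
  OverlapFree w × (∀ w' → w' isExtensionOf w → ContainsOverlap w')

-- Extremal overlap-free binary words of length 2^k + 1 exist for every k ≥ 5.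
-- Let μ be the Thue–Morse morphism 0 ↦ 01, 1 ↦ 10 and τ m = (μᵐ(1))^ω, an
-- infinite word of period 2ᵐ.  For m = k − 1 ≥ 4 the witness is
--   W = ¬τ(2) τ(3) τ(4) … τ(2^(m+1)+2)          (τ = τ m, |W| = 2^k + 1).
-- Overlap-freeness: in a μ-image every overlap has even period 2r and descends
-- to an overlap of period r of the preimage, so overlaps in τ m have period at
-- least 2ᵐ and do not fit into W after its first letter; overlaps starting at
-- the first letter are excluded by descending twice more, to τ (m − 2) with its
-- first letter complemented.
-- Extremality: an insertion into W is local.  It falls into the first ten
-- letters (independent of m), into the centre of a length-10 factor of τ m, or
-- into the last 14 letters (one of two words).  All length-10 factors of all
-- τ m lie in an explicit finite set closed under μ; for these finitely many
-- words a verified search finds the overlaps.  The one exception, appending 1,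
-- completes a square x x followed by the first letter of x.
module Submission where

open import Defs
open import Data.Bool using (Bool; true; false; not; _xor_)
open import Data.Bool.Properties using (_≟_; not-injective; not-involutive; not-¬; not-distribʳ-xor; xor-comm; xor-identityʳ)
open import Data.Empty using (⊥; ⊥-elim)
open import Data.Fin using (Fin; toℕ; fromℕ<)
open import Data.Fin.Properties using (any?; all?; toℕ-fromℕ<)
open import Data.List using (List; []; _∷_; _++_; [_]; take; drop; length; applyUpTo; upTo; concatMap; deduplicate)
open import Data.List.Properties using (≡-dec; take++drop≡id; ++-identityʳ; ++-assoc; ∷-injective; length-++; length-applyUpTo)
open import Data.List.Relation.Unary.All as All using (All)
open import Data.Nat using (ℕ; zero; suc; pred; _+_; _*_; _^_; _∸_; _≤_; _<_; z≤n; s≤s; _≤?_; _<?_; ⌊_/2⌋)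
open import Data.Nat.Properties using (+-suc; +-assoc; +-comm; +-identityʳ; *-suc; *-distribˡ-+; *-monoʳ-≤; ≤-trans; ≤-refl; ≤-<-trans; m≤m+n; m≤n+m; m<n⇒m<1+n; <⇒≤; ⌊n/2⌋≤n; +-cancelˡ-≡; +-cancelˡ-≤; +-monoʳ-≤; ≤-reflexive; m+n≤o⇒m≤o∸n; ≤-pred; <-irrefl; +-monoʳ-<; +-monoˡ-≤; m≤n⇒m<n∨m≡n; m^n>0; ≰⇒>; m≤n⇒∃[o]m+o≡n; module ≤-Reasoning)
open import Data.Nat.Tactic.RingSolver using (solve-∀)
open import Data.Product using (∃; ∃-syntax; _×_; _,_; proj₁; proj₂)
open import Data.Sum using (_⊎_; inj₁; inj₂)
open import Function using (_∘_)
open import Relation.Nullary using (Dec; yes; no; ¬_; _×-dec_)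
open import Relation.Nullary.Decidable using (True; False; from-yes; toWitness; toWitnessFalse)
open import Relation.Binary.PropositionalEquality using (_≡_; _≢_; refl; sym; trans; cong; cong₂; subst; module ≡-Reasoning)

wordEq? : (u v : Word) → Dec (u ≡ v)
wordEq? = ≡-dec _≟_

open import Data.List.Membership.DecPropositional wordEq? using (_∈_; _∈?_)

overlap-in-context : ∀ X u Z → ContainsOverlap u → ContainsOverlap (X ++ u ++ Z)
overlap-in-context X u Z (f , (p , s , refl) , ov) = f , (X ++ p , s ++ Z , reassoc) , ov
  where
  open ≡-Reasoning
  reassoc : X ++ (p ++ f ++ s) ++ Z ≡ (X ++ p) ++ f ++ s ++ Z
  reassoc = begin
    X ++ (p ++ f ++ s) ++ Z   ≡⟨ cong (X ++_) (++-assoc p (f ++ s) Z) ⟩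
    X ++ p ++ (f ++ s) ++ Z   ≡⟨ cong (λ r → X ++ p ++ r) (++-assoc f s Z) ⟩
    X ++ p ++ f ++ s ++ Z     ≡⟨ ++-assoc X p (f ++ s ++ Z) ⟨
    (X ++ p) ++ f ++ s ++ Z   ∎

false≢true : false ≢ true
false≢true ()

StartsWithOverlap : Word → ℕ → Set
StartsWithOverlap []      n = ⊥
StartsWithOverlap (a ∷ v) n = take (n + n + 2) v ≡ take n v ++ a ∷ take n v ++ [ a ]

startsWithOverlap? : ∀ w n → Dec (StartsWithOverlap w n)
startsWithOverlap? []      n = no λ ()
startsWithOverlap? (a ∷ v) n = wordEq? _ _

startsWithOverlap-sound : ∀ w n → StartsWithOverlap w n → ContainsOverlap w
startsWithOverlap-sound (a ∷ v) n e =
  _ , ([] , drop (n + n + 2) v , cong (a ∷_) v≡) , (a , take n v , refl)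
  where
  v≡ : v ≡ (take n v ++ a ∷ take n v ++ [ a ]) ++ drop (n + n + 2) v
  v≡ = trans (sym (take++drop≡id (n + n + 2) v)) (cong (_++ drop (n + n + 2) v) e)

FindsOverlap : Word → Set
FindsOverlap w =
  ∃ λ (i : Fin (length w)) → ∃ λ (n : Fin (length w)) → StartsWithOverlap (drop (toℕ i) w) (toℕ n)

findsOverlap? : ∀ w → Dec (FindsOverlap w)
findsOverlap? w = any? λ i → any? λ n → startsWithOverlap? _ _

findsOverlap-sound : ∀ w → FindsOverlap w → ContainsOverlap w
findsOverlap-sound w (i , n , s) = subst ContainsOverlap w≡ inContext
  where
  k = toℕ i
  inContext : ContainsOverlap (take k w ++ drop k w ++ [])
  inContext = overlap-in-context (take k w) (drop k w) [] (startsWithOverlap-sound _ _ s)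
  w≡ : take k w ++ drop k w ++ [] ≡ w
  w≡ = trans (cong (take k w ++_) (++-identityʳ (drop k w))) (take++drop≡id k w)

insertLetter : ℕ → Word → Bool → Word
insertLetter j u a = take j u ++ a ∷ drop j u

InsertionsOverlap : ℕ → Word → Set
InsertionsOverlap j u = FindsOverlap (insertLetter j u false) × FindsOverlap (insertLetter j u true)

insertionsOverlap? : ∀ j u → Dec (InsertionsOverlap j u)
insertionsOverlap? j u = findsOverlap? _ ×-dec findsOverlap? _

insertionsOverlap-sound : ∀ j u → InsertionsOverlap j u → ∀ a → ContainsOverlap (insertLetter j u a)
insertionsOverlap-sound j u (found , _) false = findsOverlap-sound (insertLetter j u false) found
insertionsOverlap-sound j u (_ , found) true  = findsOverlap-sound (insertLetter j u true) found

++-split : ∀ (A B C D : Word) → A ++ B ≡ C ++ D → length C ≤ length A →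
           ∃[ M ] (A ≡ C ++ M × D ≡ M ++ B)
++-split A       B []      D e _         = A , refl , sym e
++-split (a ∷ A) B (c ∷ C) D e (s≤s le) with ∷-injective e
... | refl , e′ with ++-split A B C D e′ le
...   | M , refl , refl = M , refl , refl

take-length-++ : ∀ (M N : Word) → take (length M) (M ++ N) ≡ M
take-length-++ []      N = refl
take-length-++ (c ∷ M) N = cong (c ∷_) (take-length-++ M N)

drop-length-++ : ∀ (M N : Word) → drop (length M) (M ++ N) ≡ N
drop-length-++ []      N = refl
drop-length-++ (c ∷ M) N = drop-length-++ M N

extension-in-factor : ∀ X Y Z w₁ w₂ a j → w₁ ++ w₂ ≡ X ++ Y ++ Z → length w₁ ≡ length X + j →
  j ≤ length Y → ContainsOverlap (insertLetter j Y a) → ContainsOverlap (w₁ ++ a ∷ w₂)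
extension-in-factor X Y Z w₁ w₂ a j e len j≤ co
  with ++-split w₁ w₂ X (Y ++ Z) e (subst (length X ≤_) (sym len) (m≤m+n (length X) j))
... | M , refl , e₂ with +-cancelˡ-≡ (length X) _ _ (trans (sym (length-++ X)) len)
...   | refl with ++-split Y Z M w₂ e₂ j≤
...     | N , refl , refl = subst ContainsOverlap reassoc (overlap-in-context X (M ++ a ∷ N) Z inserted)
  where
  open ≡-Reasoning
  inserted : ContainsOverlap (M ++ a ∷ N)
  inserted = subst ContainsOverlap (cong₂ (λ p s → p ++ a ∷ s) (take-length-++ M N) (drop-length-++ M N)) co
  reassoc : X ++ (M ++ a ∷ N) ++ Z ≡ (X ++ M) ++ a ∷ N ++ Z
  reassoc = begin
    X ++ (M ++ a ∷ N) ++ Z  ≡⟨ cong (X ++_) (++-assoc M (a ∷ N) Z) ⟩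
    X ++ M ++ a ∷ N ++ Z    ≡⟨ ++-assoc X M (a ∷ N ++ Z) ⟨
    (X ++ M) ++ a ∷ N ++ Z  ∎

rest-empty : ∀ (w₁ w₂ : Word) → length w₁ ≡ length (w₁ ++ w₂) → w₂ ≡ []
rest-empty []       []      _ = refl
rest-empty (_ ∷ w₁) w₂      e = rest-empty w₁ w₂ (cong pred e)

-- Infinite binary words; shift s f is f read from position s.  The window of
-- f of length L (its prefix of length L) is applyUpTo f L.
Seq : Set
Seq = ℕ → Bool

shift : ℕ → Seq → Seq
shift s f t = f (s + t)

applyUpTo-cong : ∀ (f g : Seq) L → (∀ t → t < L → f t ≡ g t) → applyUpTo f L ≡ applyUpTo g L
applyUpTo-cong f g zero    _  = refl
applyUpTo-cong f g (suc L) eq =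
  cong₂ _∷_ (eq 0 (s≤s z≤n)) (applyUpTo-cong (f ∘ suc) (g ∘ suc) L (λ t t<L → eq (suc t) (s≤s t<L)))

applyUpTo-pointwise : ∀ (f g : Seq) L → applyUpTo f L ≡ applyUpTo g L → ∀ t → t < L → f t ≡ g t
applyUpTo-pointwise f g (suc L) eq zero    _         = proj₁ (∷-injective eq)
applyUpTo-pointwise f g (suc L) eq (suc t) (s≤s t<L) =
  applyUpTo-pointwise (f ∘ suc) (g ∘ suc) L (proj₂ (∷-injective eq)) t t<L

applyUpTo-++ : ∀ (f : Seq) a b → applyUpTo f (a + b) ≡ applyUpTo f a ++ applyUpTo (shift a f) b
applyUpTo-++ f zero    b = refl
applyUpTo-++ f (suc a) b = cong (f 0 ∷_) (applyUpTo-++ (f ∘ suc) a b)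

take-applyUpTo : ∀ (f : Seq) L N → L ≤ N → take L (applyUpTo f N) ≡ applyUpTo f L
take-applyUpTo f zero    N       _         = refl
take-applyUpTo f (suc L) (suc N) (s≤s L≤N) = cong (f 0 ∷_) (take-applyUpTo (f ∘ suc) L N L≤N)

drop-applyUpTo : ∀ (f : Seq) j N → drop j (applyUpTo f N) ≡ applyUpTo (shift j f) (N ∸ j)
drop-applyUpTo f zero    N       = refl
drop-applyUpTo f (suc j) zero    = refl
drop-applyUpTo f (suc j) (suc N) = drop-applyUpTo (f ∘ suc) j N

-- The letter of a word at position i (false beyond its end).
letter : Word → ℕ → Bool
letter []      _       = false
letter (c ∷ _) zero    = c
letter (_ ∷ u) (suc i) = letter u i

letter-applyUpTo : ∀ (h : Seq) L i → i < L → letter (applyUpTo h L) i ≡ h i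
letter-applyUpTo h (suc L) zero    _         = refl
letter-applyUpTo h (suc L) (suc i) (s≤s i<L) = letter-applyUpTo (h ∘ suc) L i i<L

letter-++ˡ : ∀ u v i → i < length u → letter (u ++ v) i ≡ letter u i
letter-++ˡ (c ∷ u) v zero    _         = refl
letter-++ˡ (c ∷ u) v (suc i) (s≤s i<u) = letter-++ˡ u v i i<u

letter-++ʳ : ∀ u v i → letter (u ++ v) (length u + i) ≡ letter v i
letter-++ʳ []      v i = refl
letter-++ʳ (c ∷ u) v i = letter-++ʳ u v i

overlap-letters : ∀ a x j → j ≤ suc (length x) →
  letter (a ∷ x ++ a ∷ x ++ [ a ]) j ≡ letter (a ∷ x ++ a ∷ x ++ [ a ]) (j + suc (length x))
overlap-letters a x j j≤q with m≤n⇒m<n∨m≡n j≤q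
... | inj₁ j<q = begin
  letter (y ++ y ++ [ a ]) j          ≡⟨ letter-++ˡ y (y ++ [ a ]) j j<q ⟩
  letter y j                          ≡⟨ letter-++ˡ y [ a ] j j<q ⟨
  letter (y ++ [ a ]) j               ≡⟨ letter-++ʳ y (y ++ [ a ]) j ⟨
  letter (y ++ y ++ [ a ]) (q + j)    ≡⟨ cong (letter (y ++ y ++ [ a ])) (+-comm q j) ⟩
  letter (y ++ y ++ [ a ]) (j + q)    ∎
  where
  open ≡-Reasoning
  y = a ∷ x
  q = length y
... | inj₂ refl = begin
  letter (y ++ y ++ [ a ]) q          ≡⟨ cong (letter (y ++ y ++ [ a ])) (+-identityʳ q) ⟨
  letter (y ++ y ++ [ a ]) (q + 0)    ≡⟨ letter-++ʳ y (y ++ [ a ]) 0 ⟩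
  a                                   ≡⟨ letter-++ʳ y [ a ] 0 ⟨
  letter (y ++ [ a ]) (q + 0)         ≡⟨ cong (letter (y ++ [ a ])) (+-identityʳ q) ⟩
  letter (y ++ [ a ]) q               ≡⟨ letter-++ʳ y (y ++ [ a ]) q ⟨
  letter (y ++ y ++ [ a ]) (q + q)    ∎
  where
  open ≡-Reasoning
  y = a ∷ x
  q = length y

-- h begins with an overlap of period q: h[0..2q] = a x a x a with |a x| = q.
Overlap : Seq → ℕ → Set
Overlap h q = ∀ j → j ≤ q → h j ≡ h (j + q)

overlap-resp : ∀ {f g q} → (∀ t → f t ≡ g t) → Overlap f q → Overlap g q
overlap-resp f≗g ov j j≤q = trans (sym (f≗g j)) (trans (ov j j≤q) (f≗g _))

overlap-not : ∀ {h q} → Overlap (not ∘ h) q → Overlap h q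
overlap-not ov j j≤q = not-injective (ov j j≤q)

overlap-evens : ∀ {h r} → Overlap h (2 * r) → Overlap (λ t → h (2 * t)) r
overlap-evens {h} {r} ov j j≤r =
  trans (ov (2 * j) (*-monoʳ-≤ 2 j≤r)) (cong h (sym (*-distribˡ-+ 2 j r)))

window-overlap : ∀ (f : Seq) M → ContainsOverlap (applyUpTo f M) →
                 ∃[ s ] ∃[ q ] (1 ≤ q × s + 2 * q < M × Overlap (shift s f) q)
window-overlap f M (_ , (u , v , e) , (a , x , refl)) = length u , q , s≤s z≤n , inside (2 * q) 2q<g , ov
  where
  open ≡-Reasoning
  q = suc (length x)
  g = a ∷ x ++ a ∷ x ++ [ a ]
  length-g : ∀ l → suc (l + suc (l + 1)) ≡ 1 + 2 * suc l
  length-g = solve-∀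
  2q<g : 2 * q < length g
  2q<g = subst (2 * q <_) (sym (begin
    length g                                ≡⟨ cong suc (length-++ x) ⟩
    suc (length x + suc (length (x ++ [ a ])))  ≡⟨ cong (λ k → suc (length x + suc k)) (length-++ x) ⟩
    suc (length x + suc (length x + 1))     ≡⟨ length-g (length x) ⟩
    1 + 2 * q                               ∎)) ≤-refl
  total : M ≡ length u + (length g + length v)
  total = begin
    M                                    ≡⟨ length-applyUpTo f M ⟨
    length (applyUpTo f M)               ≡⟨ cong length e ⟩
    length (u ++ g ++ v)                 ≡⟨ length-++ u ⟩
    length u + length (g ++ v)           ≡⟨ cong (length u +_) (length-++ g) ⟩
    length u + (length g + length v)     ∎
  inside : ∀ i → i < length g → length u + i < M
  inside i i<g = subst (length u + i <_) (sym total) (+-monoʳ-< (length u) (≤-trans i<g (m≤m+n _ _)))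
  reads : ∀ i → i < length g → f (length u + i) ≡ letter g i
  reads i i<g = begin
    f (length u + i)                       ≡⟨ letter-applyUpTo f M _ (inside i i<g) ⟨
    letter (applyUpTo f M) (length u + i)  ≡⟨ cong (λ w → letter w (length u + i)) e ⟩
    letter (u ++ g ++ v) (length u + i)    ≡⟨ letter-++ʳ u (g ++ v) i ⟩
    letter (g ++ v) i                      ≡⟨ letter-++ˡ g v i i<g ⟩
    letter g i                             ∎
  ov : Overlap (shift (length u) f) q
  ov j j≤q = begin
    f (length u + j)        ≡⟨ reads j (≤-<-trans (≤-trans (m≤m+n j q) j+q≤2q) 2q<g) ⟩
    letter g j              ≡⟨ overlap-letters a x j j≤q ⟩
    letter g (j + q)        ≡⟨ reads (j + q) (≤-<-trans j+q≤2q 2q<g) ⟨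
    f (length u + (j + q))  ∎
    where
    j+q≤2q : j + q ≤ 2 * q
    j+q≤2q = ≤-trans (+-monoˡ-≤ q j≤q) (≤-reflexive (cong (q +_) (sym (+-identityʳ q))))

window-insertion : ∀ (f : Seq) a b c {w₁ w₂ x} j → w₁ ++ w₂ ≡ applyUpTo f (a + (b + c)) →
  length w₁ ≡ a + j → j ≤ b → ContainsOverlap (insertLetter j (applyUpTo (shift a f) b) x) →
  ContainsOverlap (w₁ ++ x ∷ w₂)
window-insertion f a b c j e len j≤b =
  extension-in-factor (applyUpTo f a) (applyUpTo (shift a f) b) (applyUpTo (shift b (shift a f)) c) _ _ _ j
    (trans e (trans (applyUpTo-++ f a (b + c)) (cong (applyUpTo f a ++_) (applyUpTo-++ (shift a f) b c))))
    (trans len (cong (_+ j) (sym (length-applyUpTo f a))))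
    (subst (j ≤_) (sym (length-applyUpTo (shift a f) b)) j≤b)

square-overlap : ∀ (g : Seq) P → 1 ≤ P → ContainsOverlap (applyUpTo g P ++ applyUpTo g P ++ [ g 0 ])
square-overlap g (suc P) _ = _ , ([] , [] , sym (++-identityʳ _)) , (g 0 , applyUpTo (g ∘ suc) P , refl)

data EvenOdd (n : ℕ) : Set where
  even : ∀ r → n ≡ 2 * r → EvenOdd n
  odd  : ∀ r → n ≡ 1 + 2 * r → EvenOdd n

evenOdd : ∀ n → EvenOdd n
evenOdd zero = even 0 refl
evenOdd (suc n) with evenOdd n
... | even r e = odd r (cong suc e)
... | odd  r e = even (suc r) (trans (cong suc e) (sym (*-suc 2 r)))

-- The Thue–Morse morphism 0 ↦ 01, 1 ↦ 10 on infinite words: μ g (2y) = g y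
-- and μ g (2y+1) = not (g y).
μ : Seq → Seq
μ g zero          = g zero
μ g (suc zero)    = not (g zero)
μ g (suc (suc i)) = μ (g ∘ suc) i

μ-even : ∀ g y → μ g (2 * y) ≡ g y
μ-even g zero    = refl
μ-even g (suc y) = trans (cong (μ g) (*-suc 2 y)) (μ-even (g ∘ suc) y)

μ-odd : ∀ g y → μ g (1 + 2 * y) ≡ not (g y)
μ-odd g zero    = refl
μ-odd g (suc y) = trans (cong (μ g ∘ suc) (*-suc 2 y)) (μ-odd (g ∘ suc) y)

μ-block : ∀ g y → μ g (1 + 2 * y) ≡ not (μ g (2 * y))
μ-block g y = trans (μ-odd g y) (cong not (sym (μ-even g y)))

μ-shift : ∀ g x i → μ g (2 * x + i) ≡ μ (shift x g) i
μ-shift g zero    i = refl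
μ-shift g (suc x) i = trans (cong (λ k → μ g (k + i)) (*-suc 2 x)) (μ-shift (g ∘ suc) x i)

μ-local : ∀ g h i → g ⌊ i /2⌋ ≡ h ⌊ i /2⌋ → μ g i ≡ μ h i
μ-local g h zero          e = e
μ-local g h (suc zero)    e = cong not e
μ-local g h (suc (suc i)) e = μ-local (g ∘ suc) (h ∘ suc) i e

μʷ : Word → Word
μʷ []      = []
μʷ (c ∷ u) = c ∷ not c ∷ μʷ u

μʷ-applyUpTo : ∀ h L → μʷ (applyUpTo h L) ≡ applyUpTo (μ h) (2 * L)
μʷ-applyUpTo h zero    = refl
μʷ-applyUpTo h (suc L) =
  trans (cong (λ r → h 0 ∷ not (h 0) ∷ r) (μʷ-applyUpTo (h ∘ suc) L)) (cong (applyUpTo (μ h)) (sym (*-suc 2 L)))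

μ-window : ∀ g x j L → j ≤ L →
  applyUpTo (shift (j + 2 * x) (μ g)) L ≡ take L (drop j (μʷ (applyUpTo (shift x g) L)))
μ-window g x j L j≤L = sym (begin
  take L (drop j (μʷ (applyUpTo (shift x g) L)))
    ≡⟨ cong (take L ∘ drop j) (μʷ-applyUpTo (shift x g) L) ⟩
  take L (drop j (applyUpTo (μ (shift x g)) (2 * L)))
    ≡⟨ cong (take L) (drop-applyUpTo (μ (shift x g)) j (2 * L)) ⟩
  take L (applyUpTo (shift j (μ (shift x g))) (2 * L ∸ j))
    ≡⟨ take-applyUpTo _ L (2 * L ∸ j) L≤ ⟩
  applyUpTo (shift j (μ (shift x g))) L
    ≡⟨ applyUpTo-cong _ _ L (λ t _ → trans (sym (μ-shift g x (j + t))) (cong (μ g) (reorder x j t))) ⟩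
  applyUpTo (shift (j + 2 * x) (μ g)) L ∎)
  where
  open ≡-Reasoning
  L≤ : L ≤ 2 * L ∸ j
  L≤ = m+n≤o⇒m≤o∸n L (≤-trans (+-monoʳ-≤ L j≤L) (≤-reflexive (cong (L +_) (sym (+-identityʳ L)))))
  reorder : ∀ x j t → 2 * x + (j + t) ≡ j + 2 * x + t
  reorder = solve-∀

odd? : ℕ → Bool
odd? zero    = false
odd? (suc n) = not (odd? n)

odd?-1+2r : ∀ r → odd? (1 + 2 * r) ≡ true
odd?-1+2r zero    = refl
odd?-1+2r (suc r) =
  trans (cong (odd? ∘ suc) (*-suc 2 r)) (trans (not-involutive (odd? (1 + 2 * r))) (odd?-1+2r r))

alternating : ∀ (h : Seq) m → (∀ j → j < m → h (suc j) ≡ not (h j)) → h m ≡ h 0 xor odd? m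
alternating h zero    _    = sym (xor-identityʳ (h 0))
alternating h (suc m) step = begin
  h (suc m)                  ≡⟨ step m ≤-refl ⟩
  not (h m)                  ≡⟨ cong not (alternating h m (λ j j<m → step j (m<n⇒m<1+n j<m))) ⟩
  not (h 0 xor odd? m)       ≡⟨ not-distribʳ-xor (h 0) (odd? m) ⟩
  h 0 xor odd? (suc m)       ∎
  where open ≡-Reasoning

-- Overlaps in a μ-image have even period: for odd q the letters of the
-- overlap would alternate, contradicting h 0 = h q.
μ-overlap-period-even : ∀ g s q → Overlap (shift s (μ g)) q → ∃[ r ] q ≡ 2 * r
μ-overlap-period-even g s q ov with evenOdd q
... | even r e = r , e
... | odd  r refl = ⊥-elim (not-¬ refl (trans (ov 0 z≤n) (trans (alternating h q step) returns)))
  where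
  h = shift s (μ g)
  returns : h 0 xor odd? q ≡ not (h 0)
  returns = trans (cong (h 0 xor_) (odd?-1+2r r)) (xor-comm (h 0) true)
  step : ∀ j → j < q → h (suc j) ≡ not (h j)
  step j j<q with evenOdd (s + j)
  ... | even y e = begin
    μ g (s + suc j)         ≡⟨ cong (μ g) (trans (+-suc s j) (cong suc e)) ⟩
    μ g (1 + 2 * y)         ≡⟨ μ-block g y ⟩
    not (μ g (2 * y))       ≡⟨ cong (not ∘ μ g) (sym e) ⟩
    not (μ g (s + j))       ∎
    where open ≡-Reasoning
  ... | odd y e = begin
    h (suc j)               ≡⟨ ov (suc j) j<q ⟩
    μ g (s + suc (j + q))   ≡⟨ cong (μ g) (trans (+-suc s (j + q)) (cong suc blocks)) ⟩
    μ g (1 + 2 * p)         ≡⟨ μ-block g p ⟩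
    not (μ g (2 * p))       ≡⟨ cong (not ∘ μ g) (sym blocks) ⟩
    not (h (j + q))         ≡⟨ cong not (sym (ov j (<⇒≤ j<q))) ⟩
    not (h j)               ∎
    where
    open ≡-Reasoning
    p = 1 + y + r
    sum : ∀ y r → (1 + 2 * y) + (1 + 2 * r) ≡ 2 * (1 + y + r)
    sum = solve-∀
    blocks : s + (j + q) ≡ 2 * p
    blocks = trans (sym (+-assoc s j q)) (trans (cong (_+ q) e) (sum y r))

μ-evens : ∀ g x t → shift (2 * x) (μ g) (2 * t) ≡ g (x + t)
μ-evens g x t = trans (cong (μ g) (sym (*-distribˡ-+ 2 x t))) (μ-even g (x + t))

μ-odds : ∀ g x t → shift (1 + 2 * x) (μ g) (2 * t) ≡ not (g (x + t))
μ-odds g x t = trans (cong (μ g ∘ suc) (sym (*-distribˡ-+ 2 x t))) (μ-odd g (x + t))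

μ-descent-even : ∀ g x r → Overlap (shift (2 * x) (μ g)) (2 * r) → Overlap (shift x g) r
μ-descent-even g x r ov = overlap-resp (μ-evens g x) (overlap-evens ov)

μ-descent-odd : ∀ g x r → Overlap (shift (1 + 2 * x) (μ g)) (2 * r) → Overlap (shift x g) r
μ-descent-odd g x r ov = overlap-not (overlap-resp (μ-odds g x) (overlap-evens ov))

-- τ m = (μᵐ(1))^ω, the periodic word built from the Thue–Morse block of order m.
τ : ℕ → Seq
τ zero    _ = true
τ (suc m)   = μ (τ m)

τ-periodic : ∀ m x → τ m (x + 2 ^ m) ≡ τ m x
τ-periodic zero    x = refl
τ-periodic (suc m) x with evenOdd x
... | even y refl = begin
  μ (τ m) (2 * y + 2 * 2 ^ m)  ≡⟨ cong (μ (τ m)) (sym (*-distribˡ-+ 2 y (2 ^ m))) ⟩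
  μ (τ m) (2 * (y + 2 ^ m))    ≡⟨ μ-even (τ m) (y + 2 ^ m) ⟩
  τ m (y + 2 ^ m)              ≡⟨ τ-periodic m y ⟩
  τ m y                        ≡⟨ μ-even (τ m) y ⟨
  μ (τ m) (2 * y)              ∎
  where open ≡-Reasoning
... | odd y refl = begin
  μ (τ m) (1 + (2 * y + 2 * 2 ^ m))  ≡⟨ cong (μ (τ m) ∘ suc) (sym (*-distribˡ-+ 2 y (2 ^ m))) ⟩
  μ (τ m) (1 + 2 * (y + 2 ^ m))      ≡⟨ μ-odd (τ m) (y + 2 ^ m) ⟩
  not (τ m (y + 2 ^ m))              ≡⟨ cong not (τ-periodic m y) ⟩
  not (τ m y)                        ≡⟨ μ-odd (τ m) y ⟨
  μ (τ m) (1 + 2 * y)                ∎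
  where open ≡-Reasoning

positive-half : ∀ {r} → 1 ≤ 2 * r → 1 ≤ r
positive-half {suc r} _ = s≤s z≤n

τ-overlap-period : ∀ m s q → 1 ≤ q → Overlap (shift s (τ m)) q → 2 ^ m ≤ q
τ-overlap-period zero    s q 1≤q _  = 1≤q
τ-overlap-period (suc m) s q 1≤q ov with μ-overlap-period-even (τ m) s q ov | evenOdd s
... | r , refl | even x refl =
  *-monoʳ-≤ 2 (τ-overlap-period m x r (positive-half 1≤q) (μ-descent-even (τ m) x r ov))
... | r , refl | odd x refl =
  *-monoʳ-≤ 2 (τ-overlap-period m x r (positive-half 1≤q) (μ-descent-odd (τ m) x r ov))

-- μ⁴(1) is a prefix of μ⁵(1); hence τ (4 + n) begins with μ⁴(1) for every n.
τ-prefix : ∀ n i → i < 16 → τ (4 + n) i ≡ τ 4 i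
τ-prefix zero    i _    = refl
τ-prefix (suc n) i i<16 =
  trans (μ-local (τ (4 + n)) (τ 4) i (τ-prefix n ⌊ i /2⌋ (≤-<-trans (⌊n/2⌋≤n i) i<16)))
        (applyUpTo-pointwise (τ 5) (τ 4) 16 refl i i<16)

τ-letter : ∀ n i {i<16 : True (i <? 16)} → τ (4 + n) i ≡ τ 4 i
τ-letter n i {i<16} = τ-prefix n i (toWitness i<16)

τ-differ : ∀ n i j {i<16 : True (i <? 16)} {j<16 : True (j <? 16)} {differ : False (τ 4 i ≟ τ 4 j)} →
           τ (4 + n) i ≢ τ (4 + n) j
τ-differ n i j {i<16} {j<16} {differ} e =
  toWitnessFalse differ (trans (sym (τ-letter n i {i<16})) (trans e (τ-letter n j {j<16})))

-- The length-10 factors of τ 0, …, τ 5 (τ m has period 2ᵐ, so 2ᵐ windows suffice).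
factors : List Word
factors = deduplicate wordEq? (concatMap (λ m → applyUpTo (λ x → applyUpTo (shift x (τ m)) 10) (2 ^ m)) (upTo 6))

factors-closed : All (λ u → take 10 (μʷ u) ∈ factors × take 10 (drop 1 (μʷ u)) ∈ factors) factors
factors-closed = from-yes (All.all? (λ u → (take 10 (μʷ u) ∈? factors) ×-dec (take 10 (drop 1 (μʷ u)) ∈? factors)) factors)

τ-factors : ∀ m x → applyUpTo (shift x (τ m)) 10 ∈ factors
τ-factors zero    x = from-yes (applyUpTo (shift x (τ 0)) 10 ∈? factors)
τ-factors (suc m) x with evenOdd x
... | even y refl = subst (_∈ factors) (sym (μ-window (τ m) y 0 10 z≤n))
                          (proj₁ (All.lookup factors-closed (τ-factors m y)))
... | odd  y refl = subst (_∈ factors) (sym (μ-window (τ m) y 1 10 (s≤s z≤n)))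
                          (proj₂ (All.lookup factors-closed (τ-factors m y)))

flipHead : Seq → Seq
flipHead f zero    = not (f zero)
flipHead f (suc t) = f (suc t)

flipHead-evens : ∀ g e t → flipHead (shift (2 * e) (μ g)) (2 * t) ≡ flipHead (shift e g) t
flipHead-evens g e zero    = cong not (μ-evens g e 0)
flipHead-evens g e (suc t) = μ-evens g e (suc t)

flipHead-odd-start : ∀ g e t → flipHead (shift (1 + 2 * e) (μ g)) t ≡ shift 1 (μ (flipHead (shift e g))) t
flipHead-odd-start g e zero    = cong not (μ-odds g e 0)
flipHead-odd-start g e (suc t) = begin
  μ g (1 + 2 * e + suc t)    ≡⟨ cong (μ g) (arith e t) ⟩
  μ g (2 * suc e + t)        ≡⟨ μ-shift g (suc e) t ⟩
  μ (shift (suc e) g) t      ≡⟨ μ-local _ _ t (cong g (sym (+-suc e ⌊ t /2⌋))) ⟩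
  μ (λ u → g (e + suc u)) t  ∎
  where
  open ≡-Reasoning
  arith : ∀ e t → 1 + 2 * e + suc t ≡ 2 * suc e + t
  arith = solve-∀

flipped-τ-overlap : ∀ m q → 1 ≤ q → Overlap (flipHead (τ m)) q → q ≡ 1
flipped-τ-overlap zero    (suc q) _ ov = ⊥-elim (false≢true (ov 0 z≤n))
flipped-τ-overlap (suc m) q 1≤q ov with evenOdd q
... | odd zero refl = refl
... | even r refl
  with flipped-τ-overlap m r (positive-half 1≤q) (overlap-resp (flipHead-evens (τ m) 0) (overlap-evens ov))
...   | refl = ⊥-elim (not-¬ refl (trans (sym (ov 0 z≤n)) (ov 1 (s≤s z≤n))))
flipped-τ-overlap (suc m) q 1≤q ov | odd (suc r) refl =
  ⊥-elim (incompatible m (trans (ov 1 (s≤s z≤n)) blockEven) (trans (ov 2 (s≤s (s≤s z≤n))) blockOdd))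
  where
  y = 2 + r
  blockEven : μ (τ m) (1 + (1 + 2 * suc r)) ≡ τ m y
  blockEven = trans (cong (μ (τ m)) (sym (*-suc 2 (suc r)))) (μ-even (τ m) y)
  blockOdd : μ (τ m) (2 + (1 + 2 * suc r)) ≡ not (τ m y)
  blockOdd = trans (cong (μ (τ m) ∘ suc) (sym (*-suc 2 (suc r)))) (μ-odd (τ m) y)
  incompatible : ∀ m → not (τ m 0) ≡ τ m y → τ m 1 ≡ not (τ m y) → ⊥
  incompatible zero     first _      = false≢true first
  incompatible (suc m′) first second =
    not-¬ refl (sym (trans second (trans (cong not (sym first)) (not-involutive (τ m′ 0)))))

witnessSeq : ℕ → Seq
witnessSeq m = flipHead (shift 2 (τ m))

witness : ℕ → Word
witness n = applyUpTo (witnessSeq (4 + n)) (2 ^ (5 + n) + 1)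

witness-evens : ∀ n {r} → Overlap (witnessSeq (4 + n)) (2 * r) → Overlap (shift 1 (μ (flipHead (τ (2 + n))))) r
witness-evens n ov =
  overlap-resp (flipHead-odd-start (τ (2 + n)) 0) (overlap-resp (flipHead-evens (τ (3 + n)) 1) (overlap-evens ov))

witness-even-overlap : ∀ n r → 1 ≤ r → Overlap (witnessSeq (4 + n)) (2 * r) → r ≡ 2
witness-even-overlap n r 1≤r ov with μ-overlap-period-even (flipHead (τ (2 + n))) 1 r (witness-evens n ov)
... | r′ , refl = cong (2 *_) (flipped-τ-overlap (2 + n) r′ (positive-half 1≤r)
                                (μ-descent-odd (flipHead (τ (2 + n))) 0 r′ (witness-evens n ov)))

witness-no-prefix-overlap : ∀ n q → 1 ≤ q → ¬ Overlap (witnessSeq (4 + n)) q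
witness-no-prefix-overlap n q 1≤q ov with evenOdd q
... | even r refl with witness-even-overlap n r (positive-half 1≤q) ov
...   | refl = τ-differ n 3 7 (ov 1 (s≤s z≤n))
witness-no-prefix-overlap n q 1≤q ov | odd zero refl = τ-differ n 3 4 (ov 1 (s≤s z≤n))
witness-no-prefix-overlap n q 1≤q ov | odd (suc zero) refl = τ-differ n 5 8 (ov 3 (s≤s (s≤s (s≤s z≤n))))
witness-no-prefix-overlap n q 1≤q ov | odd (suc (suc r)) refl = not-¬ refl (begin
  μ g (2 * p)                ≡⟨ cong (μ g) (sym (block r)) ⟩
  τ (4 + n) (2 + (3 + q))    ≡⟨ ov 3 (s≤s (s≤s (s≤s z≤n))) ⟨
  τ (4 + n) 5                ≡⟨ trans (τ-letter n 5) (sym (τ-letter n 6)) ⟩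
  τ (4 + n) 6                ≡⟨ ov 4 (s≤s (s≤s (s≤s (≤-trans (s≤s z≤n) (m≤n+m _ r))))) ⟩
  τ (4 + n) (2 + (4 + q))    ≡⟨ cong (μ g ∘ suc) (block r) ⟩
  μ g (1 + 2 * p)            ≡⟨ μ-block g p ⟩
  not (μ g (2 * p))          ∎)
  where
  open ≡-Reasoning
  g = τ (3 + n)
  p = 5 + r
  block : ∀ r → 2 + (3 + (1 + 2 * suc (suc r))) ≡ 2 * (5 + r)
  block = solve-∀

-- Every other overlap in the witness lies inside τ (4 + n) and is too long.
witness-no-overlap-at : ∀ n s q → 1 ≤ q → s + 2 * q < 2 ^ (5 + n) + 1 →
                        ¬ Overlap (shift s (witnessSeq (4 + n))) q
witness-no-overlap-at n zero    q 1≤q _     ov = witness-no-prefix-overlap n q 1≤q ov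
witness-no-overlap-at n (suc s) q 1≤q inside ov = <-irrefl refl (begin-strict
  2 * q                ≤⟨ m≤n+m (2 * q) s ⟩
  s + 2 * q            <⟨ ≤-pred (subst (suc s + 2 * q <_) (+-comm (2 ^ (5 + n)) 1) inside) ⟩
  2 ^ (5 + n)          ≤⟨ *-monoʳ-≤ 2 (τ-overlap-period (4 + n) (3 + s) q 1≤q ov) ⟩
  2 * q                ∎)
  where open ≤-Reasoning

witness-overlap-free : ∀ n → OverlapFree (witness n)
witness-overlap-free n co with window-overlap (witnessSeq (4 + n)) (2 ^ (5 + n) + 1) co
... | s , q , 1≤q , fits , ov = witness-no-overlap-at n s q 1≤q fits ov

factor-insertions : All (InsertionsOverlap 5) factors
factor-insertions = from-yes (All.all? (insertionsOverlap? 5) factors)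

witness-prefix : ∀ n → applyUpTo (witnessSeq (4 + n)) 10 ≡ applyUpTo (witnessSeq 4) 10
witness-prefix n = applyUpTo-cong _ _ 10 same
  where
  same : ∀ t → t < 10 → witnessSeq (4 + n) t ≡ witnessSeq 4 t
  same zero    _    = cong not (τ-letter n 2)
  same (suc t) t<10 = τ-prefix n (3 + t) (≤-trans (s≤s (s≤s t<10)) (m≤m+n 12 4))

prefix-insertions-check : ∀ (j : Fin 6) → InsertionsOverlap (toℕ j) (applyUpTo (witnessSeq 4) 10)
prefix-insertions-check = from-yes (all? {n = 6} λ j → insertionsOverlap? (toℕ j) (applyUpTo (witnessSeq 4) 10))

prefix-insertions : ∀ n j → j ≤ 5 → ∀ x → ContainsOverlap (insertLetter j (applyUpTo (witnessSeq (4 + n)) 10) x)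
prefix-insertions n j j≤5 x =
  subst (λ u → ContainsOverlap (insertLetter j u x)) (sym (witness-prefix n))
    (subst (λ i → ContainsOverlap (insertLetter i (applyUpTo (witnessSeq 4) 10) x)) (toℕ-fromℕ< (s≤s j≤5))
      (insertionsOverlap-sound _ _ (prefix-insertions-check (fromℕ< (s≤s j≤5))) x))

-- The last 14 letters of the witness are τ (4 + n) read from 3 + tailPos n;
-- they alternate between two words.
tailPos : ℕ → ℕ
tailPos zero    = 18
tailPos (suc n) = 14 + 2 * tailPos n

tailPos-spec : ∀ n → 2 ^ (5 + n) ≡ tailPos n + 14
tailPos-spec zero    = refl
tailPos-spec (suc n) = trans (cong (2 *_) (tailPos-spec n)) (arith (tailPos n))
  where
  arith : ∀ p → 2 * (p + 14) ≡ 14 + 2 * p + 14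
  arith = solve-∀

witness-length : ∀ n → 2 ^ (5 + n) + 1 ≡ tailPos n + 15
witness-length n = trans (cong (_+ 1) (tailPos-spec n)) (+-assoc (tailPos n) 14 1)

witness-split : ∀ n a b c → tailPos n + 15 ≡ a + (b + c) →
                witness n ≡ applyUpTo (witnessSeq (4 + n)) (a + (b + c))
witness-split n a b c eq = cong (applyUpTo (witnessSeq (4 + n))) (trans (witness-length n) eq)

split-length : ∀ n (w₁ w₂ : Word) → w₁ ++ w₂ ≡ witness n → length (w₁ ++ w₂) ≡ tailPos n + 15
split-length n w₁ w₂ e =
  trans (cong length e) (trans (length-applyUpTo (witnessSeq (4 + n)) (2 ^ (5 + n) + 1)) (witness-length n))

tailWindow : ℕ → Word
tailWindow n = applyUpTo (shift (3 + tailPos n) (τ (4 + n))) 14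

nextTail : Word → Word
nextTail u = take 14 (drop 11 (μʷ u))

tailWindow-step : ∀ n → tailWindow (suc n) ≡ nextTail (tailWindow n)
tailWindow-step n =
  trans (cong (λ s → applyUpTo (shift s (τ (5 + n))) 14) (arith (tailPos n)))
        (μ-window (τ (4 + n)) (3 + tailPos n) 11 14 (m≤m+n 11 3))
  where
  arith : ∀ p → 3 + (14 + 2 * p) ≡ 11 + 2 * (3 + p)
  arith = solve-∀

tail-two-cycle : nextTail (tailWindow 0) ≡ tailWindow 1 × nextTail (tailWindow 1) ≡ tailWindow 0
tail-two-cycle = refl , refl

tailWindow-cases : ∀ n → tailWindow n ≡ tailWindow 0 ⊎ tailWindow n ≡ tailWindow 1
tailWindow-cases zero    = inj₁ refl
tailWindow-cases (suc n) with tailWindow-cases n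
... | inj₁ e = inj₂ (trans (tailWindow-step n) (trans (cong nextTail e) (proj₁ tail-two-cycle)))
... | inj₂ e = inj₁ (trans (tailWindow-step n) (trans (cong nextTail e) (proj₂ tail-two-cycle)))

-- Insertions into the last 14 letters from position 10 on create overlaps,
-- except appending 1 at the very end (a finite check on both words).
TailInsertionsOverlap : Word → Set
TailInsertionsOverlap E =
  (∀ (d : Fin 4) → InsertionsOverlap (10 + toℕ d) E) × FindsOverlap (insertLetter 14 E false)

tailInsertionsOverlap? : ∀ E → Dec (TailInsertionsOverlap E)
tailInsertionsOverlap? E = all? {n = 4} (λ d → insertionsOverlap? (10 + toℕ d) E) ×-dec findsOverlap? _

tail-insertions : ∀ n → TailInsertionsOverlap (tailWindow n)
tail-insertions n with tailWindow-cases n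
... | inj₁ e = subst TailInsertionsOverlap (sym e) (from-yes (tailInsertionsOverlap? (tailWindow 0)))
... | inj₂ e = subst TailInsertionsOverlap (sym e) (from-yes (tailInsertionsOverlap? (tailWindow 1)))

tail-insertions-before-end : ∀ n d → d < 4 → ∀ x → ContainsOverlap (insertLetter (10 + d) (tailWindow n) x)
tail-insertions-before-end n d d<4 = insertionsOverlap-sound (10 + d) (tailWindow n)
  (subst (λ j → InsertionsOverlap (10 + j) (tailWindow n)) (toℕ-fromℕ< d<4) (proj₁ (tail-insertions n) (fromℕ< d<4)))

-- Appending 1 = τ(3) to the witness completes the square (τ(3) … τ(2ᵐ+2))²
-- (τ m has period 2ᵐ) followed by τ(3), an overlap.
witness-append-overlap : ∀ n → ContainsOverlap (witness n ++ [ true ])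
witness-append-overlap n = subst ContainsOverlap (sym split) (overlap-in-context [ f 0 ] _ [] (square-overlap g P (m^n>0 2 m)))
  where
  open ≡-Reasoning
  m = 4 + n
  P = 2 ^ m
  f = witnessSeq m
  g = shift 3 (τ m)
  length-split : ∀ P → 2 * P + 1 ≡ 1 + (P + P)
  length-split = solve-∀
  reorder : ∀ P t → 3 + (P + t) ≡ 3 + t + P
  reorder = solve-∀
  periodic : applyUpTo (shift P g) P ≡ applyUpTo g P
  periodic = applyUpTo-cong _ _ P (λ t _ → trans (cong (τ m) (reorder P t)) (τ-periodic m (3 + t)))
  split : witness n ++ [ true ] ≡ [ f 0 ] ++ (applyUpTo g P ++ applyUpTo g P ++ [ g 0 ]) ++ []
  split = begin
    applyUpTo f (2 * P + 1) ++ [ true ]             ≡⟨ cong (λ L → applyUpTo f L ++ [ true ]) (length-split P) ⟩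
    f 0 ∷ applyUpTo g (P + P) ++ [ true ]           ≡⟨ cong (λ w → f 0 ∷ w ++ [ true ]) (applyUpTo-++ g P P) ⟩
    f 0 ∷ (applyUpTo g P ++ applyUpTo (shift P g) P) ++ [ true ]
                                                    ≡⟨ cong (λ w → f 0 ∷ (applyUpTo g P ++ w) ++ [ true ]) periodic ⟩
    f 0 ∷ (applyUpTo g P ++ applyUpTo g P) ++ [ true ]
                                                    ≡⟨ cong (f 0 ∷_) (++-assoc (applyUpTo g P) (applyUpTo g P) [ true ]) ⟩
    f 0 ∷ applyUpTo g P ++ applyUpTo g P ++ [ true ]
                                                    ≡⟨ cong (λ b → f 0 ∷ applyUpTo g P ++ applyUpTo g P ++ [ b ]) (τ-letter n 3) ⟨
    f 0 ∷ applyUpTo g P ++ applyUpTo g P ++ [ g 0 ] ≡⟨ cong (f 0 ∷_) (++-identityʳ _) ⟨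
    [ f 0 ] ++ (applyUpTo g P ++ applyUpTo g P ++ [ g 0 ]) ++ [] ∎

-- Where an insertion into the witness of length p + 15 (p = tailPos n) happens:
-- among the first six positions, at the centre of a window of ten letters of τ,
-- or among the last five positions.
data Zone (p i : ℕ) : Set where
  head   : i ≤ 5 → Zone p i
  middle : ∀ c r → i ≡ 6 + c → c + r ≡ p + 4 → Zone p i
  tail   : ∀ d → i ≡ suc p + (10 + d) → d ≤ 4 → Zone p i

zone : ∀ p i → i ≤ p + 15 → Zone p i
zone p i i≤ with i ≤? 5 | i ≤? p + 10
... | yes i≤5 | _ = head i≤5
... | no i≰5  | yes i≤p+10 with m≤n⇒∃[o]m+o≡n (≰⇒> i≰5) | m≤n⇒∃[o]m+o≡n i≤p+10
...   | c , refl | r , e = middle c r refl (+-cancelˡ-≡ 6 (c + r) (p + 4) (trans e (arith p)))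
  where
  arith : ∀ p → p + 10 ≡ 6 + (p + 4)
  arith = solve-∀
zone p i i≤ | no _ | no i≰p+10 with m≤n⇒∃[o]m+o≡n (≰⇒> i≰p+10)
... | d , refl = tail d (shape p d) (+-cancelˡ-≤ (suc (p + 10)) d 4 (≤-trans i≤ (≤-reflexive (arith p))))
  where
  shape : ∀ p d → suc (p + 10) + d ≡ suc p + (10 + d)
  shape = solve-∀
  arith : ∀ p → p + 15 ≡ suc (p + 10) + 4
  arith = solve-∀

head-extensions : ∀ n x w₁ w₂ → w₁ ++ w₂ ≡ witness n → length w₁ ≤ 5 → ContainsOverlap (w₁ ++ x ∷ w₂)
head-extensions n x w₁ w₂ e i≤5 =
  window-insertion (witnessSeq (4 + n)) 0 10 (p + 5) (length w₁) (trans e (witness-split n 0 10 (p + 5) (arith p)))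
    refl (≤-trans i≤5 (m≤m+n 5 5)) (prefix-insertions n (length w₁) i≤5 x)
  where
  p = tailPos n
  arith : ∀ p → p + 15 ≡ 0 + (10 + (p + 5))
  arith = solve-∀

-- Insertions at position 6 + c happen at the centre of the length-10 factor
-- of τ (4 + n) starting at 3 + c.
middle-extensions : ∀ n x c r w₁ w₂ → w₁ ++ w₂ ≡ witness n → length w₁ ≡ 6 + c → c + r ≡ tailPos n + 4 →
                    ContainsOverlap (w₁ ++ x ∷ w₂)
middle-extensions n x c r w₁ w₂ e i≡ c+r≡ =
  window-insertion (witnessSeq (4 + n)) (1 + c) 10 r 5 (trans e (witness-split n (1 + c) 10 r split))
    (trans i≡ (centre c)) (m≤m+n 5 5)
    (insertionsOverlap-sound 5 (applyUpTo (shift (3 + c) (τ (4 + n))) 10)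
      (All.lookup factor-insertions (τ-factors (4 + n) (3 + c))) x)
  where
  regroup₁ : ∀ p → p + 15 ≡ p + 4 + 11
  regroup₁ = solve-∀
  regroup₂ : ∀ c r → c + r + 11 ≡ 1 + c + (10 + r)
  regroup₂ = solve-∀
  split : tailPos n + 15 ≡ 1 + c + (10 + r)
  split = trans (regroup₁ (tailPos n)) (trans (cong (_+ 11) (sym c+r≡)) (regroup₂ c r))
  centre : ∀ c → 6 + c ≡ 1 + c + 5
  centre = solve-∀

tail-window-insertion : ∀ n d x w₁ w₂ → w₁ ++ w₂ ≡ witness n → length w₁ ≡ suc (tailPos n) + (10 + d) → d ≤ 4 →
  ContainsOverlap (insertLetter (10 + d) (tailWindow n) x) → ContainsOverlap (w₁ ++ x ∷ w₂)
tail-window-insertion n d x w₁ w₂ e i≡ d≤4 =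
  window-insertion (witnessSeq (4 + n)) (suc p) 14 0 (10 + d) (trans e (witness-split n (suc p) 14 0 (arith p)))
    i≡ (+-monoʳ-≤ 10 d≤4)
  where
  p = tailPos n
  arith : ∀ p → p + 15 ≡ suc p + (14 + 0)
  arith = solve-∀

tail-extensions : ∀ n d x w₁ w₂ → w₁ ++ w₂ ≡ witness n → length w₁ ≡ suc (tailPos n) + (10 + d) → d ≤ 4 →
                  ContainsOverlap (w₁ ++ x ∷ w₂)
tail-extensions n d x w₁ w₂ e i≡ d≤4 with m≤n⇒m<n∨m≡n d≤4
... | inj₁ d<4 = tail-window-insertion n d x w₁ w₂ e i≡ d≤4 (tail-insertions-before-end n d d<4 x)
tail-extensions n d false w₁ w₂ e i≡ d≤4 | inj₂ refl =
  tail-window-insertion n 4 false w₁ w₂ e i≡ d≤4 (findsOverlap-sound _ (proj₂ (tail-insertions n)))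
tail-extensions n d true w₁ w₂ e i≡ d≤4 | inj₂ refl =
  subst (λ v → ContainsOverlap (w₁ ++ true ∷ v)) (sym w₂≡[])
    (subst (λ w → ContainsOverlap (w ++ [ true ])) W≡w₁ (witness-append-overlap n))
  where
  arith : ∀ p → suc p + 14 ≡ p + 15
  arith = solve-∀
  w₂≡[] : w₂ ≡ []
  w₂≡[] = rest-empty w₁ w₂ (trans i≡ (trans (arith (tailPos n)) (sym (split-length n w₁ w₂ e))))
  W≡w₁ : witness n ≡ w₁
  W≡w₁ = trans (sym e) (trans (cong (w₁ ++_) w₂≡[]) (++-identityʳ w₁))

witness-extensions : ∀ n w₁ w₂ x → w₁ ++ w₂ ≡ witness n → ContainsOverlap (w₁ ++ x ∷ w₂)
witness-extensions n w₁ w₂ x e with zone (tailPos n) (length w₁) fits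
  where
  fits : length w₁ ≤ tailPos n + 15
  fits = subst (length w₁ ≤_) (trans (sym (length-++ w₁)) (split-length n w₁ w₂ e)) (m≤m+n _ _)
... | head i≤5                = head-extensions n x w₁ w₂ e i≤5
... | middle c r i≡ c+r≡      = middle-extensions n x c r w₁ w₂ e i≡ c+r≡
... | tail d i≡ d≤4           = tail-extensions n d x w₁ w₂ e i≡ d≤4

lemma3p5 : ∀ (k : ℕ) → 5 ≤ k → ∃[ w ] (length w ≡ 2 ^ k + 1 × ExtremalOverlapFree w)
lemma3p5 k 5≤k with m≤n⇒∃[o]m+o≡n 5≤k
... | n , refl = witness n , length-applyUpTo _ _ , witness-overlap-free n , extensions
  where
  extensions : ∀ w′ → w′ isExtensionOf witness n → ContainsOverlap w′
  extensions _ (w₁ , w₂ , x , e , refl) = witness-extensions n w₁ w₂ x e
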